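{- Let $\mathrm{Rec}$ be the model over $\mathbb N$ of all total recursive functions $\mathbb N\to\mathbb N$ and $\mathrm{PR}$ the model over $\mathbb N$ of all partial recursive functions $\mathbb N\to\mathbb N\cup\{\bot\}$. Neither $\mathrm{Rec}$ nor $\mathrm{PR}$ is strongly equivalent to any proper submodel or proper supermodel of itself (i.e. to any model $M$ over $\mathbb N$ with $M\subsetneq\mathrm{Rec}$ or $M\supsetneq\mathrm{Rec}$, respectively $M\subsetneq\mathrm{PR}$ or $M\supsetneq\mathrm{PR}$).
   Context: A model of computation over a set $X$ is any set of functions $f:X\to X\cup\{\bot\}$, where $\bot$ denotes "undefined". Bijections are extended by $\pi(\bot)=\bot$. $A\succsim_\pi B$ means: for every $g\in B$ there is $f\in A$ with $\pi\circ g=f\circ\pi$. $A$ and $B$ are strongly equivalent if there are bijections $\pi:\mathrm{dom}\,B\to\mathrm{dom}\,A$, $\tau:\mathrm{dom}\,A\to\mathrm{dom}\,B$ with $A\succsim_\pi B$ and $B\succsim_\tau A$. -}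

module Defs where

open import Level using (Level; _⊔_) renaming (zero to 0ℓ; suc to lsuc)
open import Data.Nat using (ℕ; zero; suc; _<_)
open import Data.Fin using (Fin)
open import Data.Vec using (Vec; []; _∷_; lookup; map)
open import Data.Product using (Σ; ∃; _×_; _,_)
open import Relation.Nullary using (¬_)
open import Relation.Binary.PropositionalEquality using (_≡_)
open import Function.Bundles using (_⤖_; Bijection)

-- Partial functions ℕ → ℕ ∪ {⊥}, represented by their (single-valued)
-- graph: `graph x y` means f(x) = y; f(x) = ⊥ iff no y satisfies it.

record PFun : Set₁ where
  field
    graph      : ℕ → ℕ → Set
    functional : ∀ {x y z} → graph x y → graph x z → y ≡ z
open PFun public

_⇔'_ : ∀ {a b} → Set a → Set b → Set (a ⊔ b)
A ⇔' B = (A → B) × (B → A)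

_≈ᶠ_ : PFun → PFun → Set
f ≈ᶠ g = ∀ x y → graph f x y ⇔' graph g x y

Model : (ℓ : Level) → Set (lsuc 0ℓ ⊔ lsuc ℓ)
Model ℓ = PFun → Set ℓ

_⊆ᴹ_ : ∀ {ℓ ℓ'} → Model ℓ → Model ℓ' → Set (lsuc 0ℓ ⊔ ℓ ⊔ ℓ')
A ⊆ᴹ B = ∀ f → A f → Σ PFun λ g → B g × (f ≈ᶠ g)

_⊊ᴹ_ : ∀ {ℓ ℓ'} → Model ℓ → Model ℓ' → Set (lsuc 0ℓ ⊔ ℓ ⊔ ℓ')
A ⊊ᴹ B = (A ⊆ᴹ B) × ¬ (B ⊆ᴹ A)

-- A ≿_π B : for every g ∈ B there is f ∈ A with π ∘ g = f ∘ π
-- (π extended by π(⊥) = ⊥).  (π ∘ g)(x) = y iff ∃ z, g(x) = z ∧ π z = y;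
-- (f ∘ π)(x) = y iff f(π x) = y.
_≿[_]_ : ∀ {ℓ ℓ'} → Model ℓ → (ℕ → ℕ) → Model ℓ' → Set (lsuc 0ℓ ⊔ ℓ ⊔ ℓ')
A ≿[ π ] B = ∀ g → B g → Σ PFun λ f → A f ×
  (∀ x y → (Σ ℕ λ z → graph g x z × π z ≡ y) ⇔' graph f (π x) y)

StronglyEquivalent : ∀ {ℓ ℓ'} → Model ℓ → Model ℓ' → Set (lsuc 0ℓ ⊔ ℓ ⊔ ℓ')
StronglyEquivalent A B =
  Σ (ℕ ⤖ ℕ) λ π → Σ (ℕ ⤖ ℕ) λ τ →
    (A ≿[ Bijection.to π ] B) × (B ≿[ Bijection.to τ ] A)

data Code : ℕ → Set where
  zeroᶜ : Code 0
  succᶜ : Code 1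
  proj  : ∀ {n} → Fin n → Code n
  comp  : ∀ {m n} → Code m → Vec (Code n) m → Code n
  prec  : ∀ {n} → Code n → Code (suc (suc n)) → Code (suc n)
  mu    : ∀ {n} → Code (suc n) → Code n

mutual
  data Eval : ∀ {n} → Code n → Vec ℕ n → ℕ → Set where
    ev-zero : Eval zeroᶜ [] 0
    ev-succ : ∀ {x} → Eval succᶜ (x ∷ []) (suc x)
    ev-proj : ∀ {n} {i : Fin n} {xs} → Eval (proj i) xs (lookup xs i)
    ev-comp : ∀ {m n} {f : Code m} {gs : Vec (Code n) m} {xs ys y} →
              EvalAll gs xs ys → Eval f ys y → Eval (comp f gs) xs y
    ev-prec-z : ∀ {n} {f : Code n} {g xs y} →
              Eval f xs y → Eval (prec f g) (0 ∷ xs) y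
    ev-prec-s : ∀ {n} {f : Code n} {g xs k r y} →
              Eval (prec f g) (k ∷ xs) r → Eval g (k ∷ r ∷ xs) y →
              Eval (prec f g) (suc k ∷ xs) y
    ev-mu   : ∀ {n} {f : Code (suc n)} {xs y} →
              Eval f (y ∷ xs) 0 →
              (∀ k → k < y → Σ ℕ λ m → Eval f (k ∷ xs) (suc m)) →
              Eval (mu f) xs y

  data EvalAll : ∀ {m n} → Vec (Code n) m → Vec ℕ n → Vec ℕ m → Set where
    []  : ∀ {n} {xs : Vec ℕ n} → EvalAll [] xs []
    _∷_ : ∀ {m n} {g : Code n} {gs : Vec (Code n) m} {xs y ys} →
          Eval g xs y → EvalAll gs xs ys → EvalAll (g ∷ gs) xs (y ∷ ys)

PR : Model 0ℓ
PR f = Σ (Code 1) λ c → ∀ x y → graph f x y ⇔' Eval c (x ∷ []) y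

Total : PFun → Set
Total f = ∀ x → Σ ℕ λ y → graph f x y

Rec : Model 0ℓ
Rec f = PR f × Total f

module Submission where

open import Defs
open import Level using (Level) renaming (zero to 0ℓ)
open import Data.Nat using (ℕ; zero; suc; _+_; _∸_; pred; _<_; ∣_-_∣; ≢-nonZero)
open import Data.Nat.Properties
  using (<-cmp; <-irrefl; 0≢1+n; +-identityʳ; pred[m∸n]≡m∸[1+n]; ∣n-n∣≡0; ∣m-n∣≡0⇒m≡n; suc-pred)
open import Data.Fin using () renaming (zero to fzero; suc to fsuc)
open import Data.Vec using (Vec; []; _∷_)
open import Data.Product using (Σ; _×_; _,_; proj₁; proj₂)
open import Relation.Nullary using (¬_; contradiction)
open import Relation.Binary using (tri<; tri≈; tri>)
open import Relation.Binary.PropositionalEquality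
open import Function.Bundles using (_⤖_; Bijection; Surjection)

-- Let P be Rec or PR and M ⊊ P (resp. P ⊊ M), and let τ be the bijection by
-- which the larger model is simulated. The successor is in both models, so its
-- τ-conjugate is a recursive function c with τ(n+1) = c(τ n). Hence τ(n) is
-- computed by iterating c n times and τ⁻¹ by unbounded search, so conjugation
-- by τ maps P into itself. Simulation then places every function of the larger
-- model, up to this conjugation, in the smaller one: the reverse inclusion
-- that properness forbids.

mutual
  Eval-deterministic : ∀ {n} {c : Code n} {xs y z} → Eval c xs y → Eval c xs z → y ≡ z
  Eval-deterministic ev-zero ev-zero = refl
  Eval-deterministic ev-succ ev-succ = refl
  Eval-deterministic ev-proj ev-proj = refl
  Eval-deterministic (ev-comp as e) (ev-comp as′ e′)
    with EvalAll-deterministic as as′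
  ... | refl = Eval-deterministic e e′
  Eval-deterministic (ev-prec-z e) (ev-prec-z e′) = Eval-deterministic e e′
  Eval-deterministic (ev-prec-s r e) (ev-prec-s r′ e′)
    with Eval-deterministic r r′
  ... | refl = Eval-deterministic e e′
  Eval-deterministic {y = y} {z} (ev-mu e below) (ev-mu e′ below′) with <-cmp y z
  ... | tri< y<z _ _ = contradiction (Eval-deterministic e (proj₂ (below′ y y<z))) 0≢1+n
  ... | tri≈ _ y≡z _ = y≡z
  ... | tri> _ _ z<y = contradiction (Eval-deterministic e′ (proj₂ (below z z<y))) 0≢1+n

  EvalAll-deterministic : ∀ {m n} {gs : Vec (Code n) m} {xs ys zs} →
                          EvalAll gs xs ys → EvalAll gs xs zs → ys ≡ zs
  EvalAll-deterministic [] [] = refl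
  EvalAll-deterministic (e ∷ es) (e′ ∷ es′) =
    cong₂ _∷_ (Eval-deterministic e e′) (EvalAll-deterministic es es′)

⟦_⟧ : Code 1 → PFun
⟦ c ⟧ = record { graph = λ x y → Eval c (x ∷ []) y ; functional = Eval-deterministic }

Represents : Code 1 → PFun → Set
Represents c f = ∀ x y → graph f x y ⇔' Eval c (x ∷ []) y

_computes_ : Code 1 → (ℕ → ℕ) → Set
c computes α = ∀ x → Eval c (x ∷ []) (α x)

computes-unique : ∀ {c α x y} → c computes α → Eval c (x ∷ []) y → α x ≡ y
computes-unique {x = x} c↦α = Eval-deterministic (c↦α x)

_∘ᶜ_ : ∀ {n} → Code 1 → Code n → Code n
a ∘ᶜ b = comp a (b ∷ [])

∘ᶜ-intro : ∀ {n a} {b : Code n} {xs z y} →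
           Eval b xs z → Eval a (z ∷ []) y → Eval (a ∘ᶜ b) xs y
∘ᶜ-intro eb ea = ev-comp (eb ∷ []) ea

∘ᶜ-elim : ∀ {n a} {b : Code n} {xs y} → Eval (a ∘ᶜ b) xs y →
          Σ ℕ λ z → Eval b xs z × Eval a (z ∷ []) y
∘ᶜ-elim (ev-comp (eb ∷ []) ea) = _ , eb , ea

constᶜ : ℕ → Code 0
constᶜ zero    = zeroᶜ
constᶜ (suc m) = comp succᶜ (constᶜ m ∷ [])

constᶜ-eval : ∀ m → Eval (constᶜ m) [] m
constᶜ-eval zero    = ev-zero
constᶜ-eval (suc m) = ev-comp (constᶜ-eval m ∷ []) ev-succ

predᶜ : Code 1
predᶜ = prec zeroᶜ (proj fzero)

predᶜ-computes : predᶜ computes pred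
predᶜ-computes zero    = ev-prec-z ev-zero
predᶜ-computes (suc a) = ev-prec-s (predᶜ-computes a) ev-proj

-- The recursion runs on the first argument, so the arguments appear swapped.
monusᶜ : Code 2
monusᶜ = prec (proj fzero) (predᶜ ∘ᶜ proj (fsuc fzero))

monusᶜ-eval : ∀ b a → Eval monusᶜ (b ∷ a ∷ []) (a ∸ b)
monusᶜ-eval zero    a = ev-prec-z ev-proj
monusᶜ-eval (suc b) a = subst (Eval monusᶜ (suc b ∷ a ∷ [])) (pred[m∸n]≡m∸[1+n] a b)
  (ev-prec-s (monusᶜ-eval b a) (∘ᶜ-intro ev-proj (predᶜ-computes (a ∸ b))))

addᶜ : Code 2
addᶜ = prec (proj fzero) (succᶜ ∘ᶜ proj (fsuc fzero))

addᶜ-eval : ∀ a b → Eval addᶜ (a ∷ b ∷ []) (a + b)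
addᶜ-eval zero    b = ev-prec-z ev-proj
addᶜ-eval (suc a) b = ev-prec-s (addᶜ-eval a b) (∘ᶜ-intro ev-proj ev-succ)

∣m-n∣≡m∸n+n∸m : ∀ m n → ∣ m - n ∣ ≡ (m ∸ n) + (n ∸ m)
∣m-n∣≡m∸n+n∸m zero    zero    = refl
∣m-n∣≡m∸n+n∸m zero    (suc n) = refl
∣m-n∣≡m∸n+n∸m (suc m) zero    = sym (+-identityʳ (suc m))
∣m-n∣≡m∸n+n∸m (suc m) (suc n) = ∣m-n∣≡m∸n+n∸m m n

distᶜ : Code 2
distᶜ = comp addᶜ (comp monusᶜ (proj (fsuc fzero) ∷ proj fzero ∷ []) ∷ monusᶜ ∷ [])

distᶜ-eval : ∀ u v → Eval distᶜ (u ∷ v ∷ []) ∣ u - v ∣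
distᶜ-eval u v = subst (Eval distᶜ (u ∷ v ∷ [])) (sym (∣m-n∣≡m∸n+n∸m u v))
  (ev-comp (ev-comp (ev-proj ∷ ev-proj ∷ []) (monusᶜ-eval v u) ∷ monusᶜ-eval u v ∷ [])
           (addᶜ-eval (u ∸ v) (v ∸ u)))

iterateᶜ : Code 1 → ℕ → Code 1
iterateᶜ c a = prec (constᶜ a) (c ∘ᶜ proj (fsuc fzero))

iterateᶜ-computes : ∀ {c} {τ : ℕ → ℕ} → (∀ x → Eval c (τ x ∷ []) (τ (suc x))) →
                    iterateᶜ c (τ 0) computes τ
iterateᶜ-computes {τ = τ} step zero    = ev-prec-z (constᶜ-eval (τ 0))
iterateᶜ-computes         step (suc x) =
  ev-prec-s (iterateᶜ-computes step x) (∘ᶜ-intro ev-proj (step x))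

inverseᶜ : Code 1 → Code 1
inverseᶜ t = mu (comp distᶜ ((t ∘ᶜ proj fzero) ∷ proj (fsuc fzero) ∷ []))

-- μ-search for the least k with ∣ τ k - y ∣ = 0; by injectivity it is σ y.
inverseᶜ-computes : ∀ {t} {τ σ : ℕ → ℕ} → t computes τ → (∀ {x y} → τ x ≡ τ y → x ≡ y) →
                    (∀ y → τ (σ y) ≡ y) → inverseᶜ t computes σ
inverseᶜ-computes {t} {τ} {σ} t↦τ τ-injective τσ≗id y =
  ev-mu (subst (test (σ y)) (trans (cong ∣_- y ∣ (τσ≗id y)) (∣n-n∣≡0 y)) (test-eval (σ y)))
        below
  where
  test : ℕ → ℕ → Set
  test k = Eval (comp distᶜ ((t ∘ᶜ proj fzero) ∷ proj (fsuc fzero) ∷ [])) (k ∷ y ∷ [])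

  test-eval : ∀ k → test k ∣ τ k - y ∣
  test-eval k = ev-comp (∘ᶜ-intro ev-proj (t↦τ k) ∷ ev-proj ∷ []) (distᶜ-eval (τ k) y)

  below : ∀ k → k < σ y → Σ ℕ λ m → test k (suc m)
  below k k<σy = pred ∣ τ k - y ∣ ,
    subst (test k) (sym (suc-pred ∣ τ k - y ∣ {{≢-nonZero τk≢y}})) (test-eval k)
    where
    τk≢y : ∣ τ k - y ∣ ≢ 0
    τk≢y d≡0 = <-irrefl (τ-injective (trans (∣m-n∣≡0⇒m≡n d≡0) (sym (τσ≗id y)))) k<σy

successor : PFun
successor = record { graph = λ x y → y ≡ suc x ; functional = λ p q → trans p (sym q) }

⇔'-sym : ∀ {A B : Set} → A ⇔' B → B ⇔' A
⇔'-sym (to , from) = from , to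

⇔'-trans : ∀ {A B C : Set} → A ⇔' B → B ⇔' C → A ⇔' C
⇔'-trans (to₁ , from₁) (to₂ , from₂) = (λ a → to₂ (to₁ a)) , (λ c → from₁ (from₂ c))

-- f ∘ τ = τ ∘ g, read on graphs.
record Intertwines (τ : ℕ ⤖ ℕ) (f g : PFun) : Set where
  constructor intertwines
  field
    on-graph : ∀ x y → graph g x y ⇔' graph f (Bijection.to τ x) (Bijection.to τ y)
open Intertwines

module _ (τ : ℕ ⤖ ℕ) where
  open Bijection τ using (to; to⁻; injective)
  open Surjection (Bijection.surjection τ) using (to∘to⁻)

  ≿⇒intertwines : ∀ {ℓ ℓ′} {A : Model ℓ} {B : Model ℓ′} → A ≿[ to ] B →
                  ∀ g → B g → Σ PFun λ f → A f × Intertwines τ f g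
  ≿⇒intertwines A≿B g Bg with A≿B g Bg
  ... | f , Af , τ∘g⇔f∘τ = f , Af , intertwines λ x y →
    (λ gxy → proj₁ (τ∘g⇔f∘τ x (to y)) (y , gxy , refl)) ,
    (λ f[τx]τy → let z , gxz , τz≡τy = proj₂ (τ∘g⇔f∘τ x (to y)) f[τx]τy
                 in subst (graph g x) (injective τz≡τy) gxz)

  intertwiners-unique : ∀ {f f′ g} → Intertwines τ f g → Intertwines τ f′ g → f ≈ᶠ f′
  intertwiners-unique {f} {f′} f∼g f′∼g u v =
    subst₂ (λ u v → graph f u v ⇔' graph f′ u v) (to∘to⁻ u) (to∘to⁻ v)
      (⇔'-trans (⇔'-sym (on-graph f∼g (to⁻ u) (to⁻ v))) (on-graph f′∼g (to⁻ u) (to⁻ v)))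

  intertwined-unique : ∀ {f g g′} → Intertwines τ f g → Intertwines τ f g′ → g ≈ᶠ g′
  intertwined-unique f∼g f∼g′ x y = ⇔'-trans (on-graph f∼g x y) (⇔'-sym (on-graph f∼g′ x y))

  intertwines-successor : ∀ {f g c} → (∀ {x y} → graph f x y → Eval c (x ∷ []) y) →
                          Intertwines τ f g → (∀ x → graph g x (suc x)) →
                          ∀ x → Eval c (to x ∷ []) (to (suc x))
  intertwines-successor f⊆c f∼g g-succ x = f⊆c (proj₁ (on-graph f∼g x (suc x)) (g-succ x))

  conjugate-intertwines : ∀ {t s c f} → t computes to → s computes to⁻ → Represents c f →
                          Intertwines τ f ⟦ s ∘ᶜ (c ∘ᶜ t) ⟧
  conjugate-intertwines {t} {s} {c} {f} t↦τ s↦τ⁻ c-rep = intertwines λ x y → forth x y , back x y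
    where
    forth : ∀ x y → Eval (s ∘ᶜ (c ∘ᶜ t)) (x ∷ []) y → graph f (to x) (to y)
    forth x y e with ∘ᶜ-elim e
    ... | w , ect , es with ∘ᶜ-elim ect
    ... | v , et , ec with computes-unique t↦τ et | computes-unique s↦τ⁻ es
    ... | refl | refl = subst (graph f (to x)) (sym (to∘to⁻ w)) (proj₂ (c-rep (to x) w) ec)

    back : ∀ x y → graph f (to x) (to y) → Eval (s ∘ᶜ (c ∘ᶜ t)) (x ∷ []) y
    back x y f[τx]τy = subst (Eval (s ∘ᶜ (c ∘ᶜ t)) (x ∷ [])) (injective (to∘to⁻ (to y)))
      (∘ᶜ-intro (∘ᶜ-intro (t↦τ x) (proj₁ (c-rep (to x) (to y)) f[τx]τy)) (s↦τ⁻ (to y)))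

record ConjugationClosed (P : Model 0ℓ) : Set₁ where
  field
    represented : ∀ f → P f → PR f
    successor∈  : P successor
    conjugate∈  : ∀ {f} → P f → ∀ c → Represents c f → ∀ {a b α β} →
                  a computes α → b computes β → P ⟦ a ∘ᶜ (c ∘ᶜ b) ⟧

module _ {P : Model 0ℓ} (closed : ConjugationClosed P) where
  open ConjugationClosed closed

  conjugates-within : (τ : ℕ ⤖ ℕ) → ∀ {c} →
                      (∀ x → Eval c (Bijection.to τ x ∷ []) (Bijection.to τ (suc x))) →
                      ∀ h → P h → Σ PFun λ g → P g × Intertwines τ h g
  conjugates-within τ {c} step h Ph =
    let hc , hc-rep = represented h Ph
    in _ , conjugate∈ Ph hc hc-rep s↦τ⁻ t↦τ , conjugate-intertwines τ t↦τ s↦τ⁻ hc-rep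
    where
    open Bijection τ using (to; to⁻; injective)

    t↦τ : iterateᶜ c (to 0) computes to
    t↦τ = iterateᶜ-computes step

    s↦τ⁻ : inverseᶜ (iterateᶜ c (to 0)) computes to⁻
    s↦τ⁻ = inverseᶜ-computes t↦τ injective (Surjection.to∘to⁻ (Bijection.surjection τ))

  no-proper-submodel : ∀ {ℓ} (M : Model ℓ) → M ⊊ᴹ P → ¬ StronglyEquivalent P M
  no-proper-submodel M (M⊆P , P⊈M) (_ , τ , _ , M≿P) =
    let f , Mf , f∼succ = ≿⇒intertwines τ M≿P successor successor∈
        f′ , Pf′ , f≈f′ = M⊆P f Mf
        c , c-rep = represented f′ Pf′
        step = intertwines-successor τ (λ fxy → proj₁ (c-rep _ _) (proj₁ (f≈f′ _ _) fxy))
                                     f∼succ (λ x → refl)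
    in P⊈M λ h Ph →
      let g , Pg , h∼g = conjugates-within τ step h Ph
          f″ , Mf″ , f″∼g = ≿⇒intertwines τ M≿P g Pg
      in f″ , Mf″ , intertwiners-unique τ h∼g f″∼g

  no-proper-supermodel : ∀ {ℓ} (M : Model ℓ) → P ⊊ᴹ M → ¬ StronglyEquivalent P M
  no-proper-supermodel M (P⊆M , M⊈P) (π , _ , P≿M , _) =
    let s , Ms , successor≈s = P⊆M successor successor∈
        f , Pf , f∼s = ≿⇒intertwines π P≿M s Ms
        c , c-rep = represented f Pf
        step = intertwines-successor π (λ fxy → proj₁ (c-rep _ _) fxy)
                                     f∼s (λ x → proj₁ (successor≈s x (suc x)) refl)
    in M⊈P λ g Mg →
      let f , Pf , f∼g = ≿⇒intertwines π P≿M g Mg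
          g′ , Pg′ , f∼g′ = conjugates-within π step f Pf
      in g′ , Pg′ , intertwined-unique π f∼g f∼g′

PR-closed : ConjugationClosed PR
PR-closed = record
  { represented = λ f PRf → PRf
  ; successor∈  = succᶜ , λ x y → (λ { refl → ev-succ }) , (λ e → Eval-deterministic e ev-succ)
  ; conjugate∈  = λ _ c _ {a} {b} _ _ → a ∘ᶜ (c ∘ᶜ b) , λ x y → (λ e → e) , (λ e → e)
  }

Rec-closed : ConjugationClosed Rec
Rec-closed = record
  { represented = λ f → proj₁
  ; successor∈  = successor∈ PR-closed , λ x → suc x , refl
  ; conjugate∈  = λ { {f} (PRf , total) c c-rep {α = α} {β} a↦α b↦β →
      conjugate∈ PR-closed {f} PRf c c-rep a↦α b↦β , λ x →
        let w , f[βx]w = total (β x)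
        in α w , ∘ᶜ-intro (∘ᶜ-intro (b↦β x) (proj₁ (c-rep (β x) w) f[βx]w)) (a↦α w) }
  }
  where open ConjugationClosed

mainTheorem19 : ∀ {ℓ : Level} →
    (∀ (M : Model ℓ) → M ⊊ᴹ Rec → ¬ StronglyEquivalent Rec M) ×
    (∀ (M : Model ℓ) → Rec ⊊ᴹ M → ¬ StronglyEquivalent Rec M) ×
    (∀ (M : Model ℓ) → M ⊊ᴹ PR → ¬ StronglyEquivalent PR M) ×
    (∀ (M : Model ℓ) → PR ⊊ᴹ M → ¬ StronglyEquivalent PR M)
mainTheorem19 = no-proper-submodel Rec-closed , no-proper-supermodel Rec-closed ,
                no-proper-submodel PR-closed  , no-proper-supermodel PR-closed
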